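{- Let $(h,\gamma,\gamma')$ be a coherent triple. The map $\mathcal S_\Sigma:\Sigma^{\mathrm{ac}}\cap\Sigma^{(h,\gamma,\gamma')}\to\mathcal D(h)\cap\mathcal D(\gamma,\gamma')$ is surjective.
   Context: Let $p>2$ be a prime, $f\ge2$, $q=p^f$. A coherent triple is $(h,\gamma,\gamma')\in\mathbb Z/(q^2-1)\mathbb Z\times\mathbb Z/(q-1)\mathbb Z\times\mathbb Z/(q-1)\mathbb Z$ with $h$ not divisible by $q+1$ and $h\equiv\gamma+\gamma'+\frac{q-1}{p-1}\pmod{q-1}$; fix integer representatives. Serre weights are encoded as pairs $(s,\underline r)$, $s\in\mathbb Z/(q-1)\mathbb Z$, $\underline r=(r_0,\dots,r_{f-1})\in\{0,\dots,p-1\}^f$. $\mathcal D(h)$: the set of $(s,\underline r)$ for which there is $(\varepsilon_0,\dots,\varepsilon_{f-1})\in\{0,1\}^f$ with $h\equiv\sum_{i=0}^{f-1}(-1)^{\varepsilon_i}p^i(1+r_i)\pmod{q+1}$ and $s\equiv\frac1{q+1}\big(h-\sum_i(-1)^{\varepsilon_i}p^i(1+r_i)\big)-\sum_i\varepsilon_ip^i(1+r_i)\pmod{q-1}$. $\mathcal D(\gamma,\gamma')$: let $c_0,\dots,c_{f-1}\in\{0,\dots,p-1\}$ with $\gamma-\gamma'\equiv\sum_ic_ip^i\pmod{q-1}$ (all $c_i=0$ if $\gamma\equiv\gamma'$). For $(\varepsilon'_0,\dots,\varepsilon'_{f-1})\in\{0,1\}^f$, with $\varepsilon'_{ -1}:=\varepsilon'_{f-1}$,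 put $r_i=c_i$ if $(\varepsilon'_i,\varepsilon'_{i-1})=(0,0)$, $r_i=c_i-1$ if $(0,1)$, $r_i=p-2-c_i$ if $(1,0)$, $r_i=p-1-c_i$ if $(1,1)$; if all $r_i\in[0,p-1]$, this produces $(s,\underline r)$ with $s\equiv\gamma'+\frac12\big(\varepsilon'_{f-1}(q-1)+\sum_i(c_i-r_i)p^i\big)\pmod{q-1}$. $\mathcal D(\gamma,\gamma')$ is the set of all pairs so produced. Sequences. $\Sigma$ is the set of $2f$-periodic integer sequences $(\sigma_i)_{i\in\mathbb Z}$. A pair $(x,y)$ of integers is active if $0\le x,y\le p$, $x\in\{0,p\}$ or $y\in\{0,p\}$, and $x\ne y$; $\Sigma^{\mathrm{ac}}$ is the set of $\underline\sigma$ with $(\sigma_i,\sigma_{i+f})$ active for all $i$. $\Sigma^{(h,\gamma,\gamma')}$ is the set of $\underline\sigma$ with $\sum_{i=0}^{2f-1}\sigma_ip^{2f-1-i}\equiv h-(q+1)\gamma'\pmod{q^2-1}$. For $\underline\sigma\in\Sigma^{\mathrm{ac}}$, $\mathcal S_\Sigma(\underline\sigma)=(s,\underline r)$ where for $0\le i\le f-1$: $r_{f-1-i}=\sigma_i-1$ if $\sigma_{i+f}=0$; $=p-1-\sigma_i$ if $\sigma_{i+f}=p$; $=\sigma_{i+f}-1$ if $\sigma_i=0$; $=p-1-\sigma_{i+f}$ if $\sigma_i=p$; $\varepsilon_{f-1-i}=0$ if $\sigma_i<\sigma_{i+f}$, else $1$; and $s=\frac1{q+1}\big(h-\sum_{i=0}^{f-1}(-1)^{\varepsilon_i}(1+r_i)p^i\big)-\sum_{i=0}^{f-1}\varepsilon_i(1+r_i)p^i$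 modulo $q-1$ (this lies in $\mathbb Z/(q-1)\mathbb Z$ and $(s,\underline r)\in\mathcal D(h)\cap\mathcal D(\gamma,\gamma')$ for $\underline\sigma\in\Sigma^{\mathrm{ac}}\cap\Sigma^{(h,\gamma,\gamma')}$). -}

module Defs where

open import Data.Nat as ℕ using (ℕ; zero; suc; _∸_)
open import Data.Integer as ℤ using (ℤ; +_; _+_; _-_; _*_; -_; _≤_; _<_; _≟_; _<?_)
open import Data.Integer.Divisibility using (_∣_)
open import Data.Integer.DivMod using (_/ℕ_)
open import Data.Bool using (Bool; true; false; if_then_else_; not)
open import Data.Product using (Σ; ∃; _×_; _,_; proj₁; proj₂)
open import Data.Sum using (_⊎_)
open import Relation.Binary.PropositionalEquality using (_≡_; _≢_)
open import Relation.Nullary using (¬_)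
open import Relation.Nullary.Decidable using (⌊_⌋)

infix 4 _≅_[mod_]
_≅_[mod_] : ℤ → ℤ → ℤ → Set
a ≅ b [mod n ] = n ∣ (a - b)

sumℤ : ℕ → (ℕ → ℤ) → ℤ
sumℤ zero    g = + 0
sumℤ (suc n) g = sumℤ n g + g n

pw : ℕ → ℕ → ℤ
pw p i = + (p ℕ.^ i)

-- q = p^f, q - 1, q + 1 (as ℕ, for exact division), q^2 - 1
qZ : ℕ → ℕ → ℤ
qZ p f = pw p f

q-1 : ℕ → ℕ → ℤ
q-1 p f = qZ p f - + 1

q+1ℕ : ℕ → ℕ → ℕ
q+1ℕ p f = suc (p ℕ.^ f)

q²-1 : ℕ → ℕ → ℤ
q²-1 p f = qZ p f * qZ p f - + 1

-- (-1)^ε · x   and   ε · x   for ε ∈ {0,1} (false = 0, true = 1)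
sgn : Bool → ℤ → ℤ
sgn false x = x
sgn true  x = - x

ind : Bool → ℤ → ℤ
ind false x = + 0
ind true  x = x

-- Coherent triples (integer representatives).
-- (q-1)/(p-1) is written as 1 + p + ... + p^{f-1}.

record Coherent (p f : ℕ) (h γ γ' : ℤ) : Set where
  field
    h-not-div : ¬ (+ (q+1ℕ p f) ∣ h)
    h-cong    : h ≅ γ + γ' + sumℤ f (pw p) [mod q-1 p f ]

-- Serre weights (s , r): s ∈ ℤ (read modulo q-1), r i ∈ {0..p-1} for i < f.

WeightRange : ℕ → ℕ → (ℕ → ℤ) → Set
WeightRange p f r = ∀ i → i ℕ.< f → (+ 0 ≤ r i) × (r i ≤ + p - + 1)

WeightEq : ℕ → ℕ → ℤ → (ℕ → ℤ) → ℤ → (ℕ → ℤ) → Set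
WeightEq p f s r s' r' = (s ≅ s' [mod q-1 p f ]) × (∀ i → i ℕ.< f → r i ≡ r' i)

InDh : ℕ → ℕ → ℤ → ℤ → (ℕ → ℤ) → Set
InDh p f h s r =
  Σ (ℕ → Bool) λ ε →
    let X = sumℤ f (λ i → sgn (ε i) (pw p i * (+ 1 + r i)))
        Y = sumℤ f (λ i → ind (ε i) (pw p i * (+ 1 + r i)))
    in (h ≅ X [mod + q+1ℕ p f ])
     × (s ≅ ((h - X) /ℕ q+1ℕ p f) - Y [mod q-1 p f ])

IsDigits : ℕ → ℕ → ℤ → ℤ → (ℕ → ℤ) → Set
IsDigits p f γ γ' c =
    (∀ i → i ℕ.< f → (+ 0 ≤ c i) × (c i ≤ + p - + 1))
  × (γ - γ' ≅ sumℤ f (λ i → c i * pw p i) [mod q-1 p f ])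
  × (γ ≅ γ' [mod q-1 p f ] → ∀ i → i ℕ.< f → c i ≡ + 0)

rule : ℕ → Bool → Bool → ℤ → ℤ
rule p false false c = c
rule p false true  c = c - + 1
rule p true  false c = + p - + 2 - c
rule p true  true  c = + p - + 1 - c

prevε : ℕ → (ℕ → Bool) → ℕ → Bool
prevε f ε zero    = ε (f ∸ 1)
prevε f ε (suc i) = ε i

InDγ : ℕ → ℕ → ℤ → ℤ → ℤ → (ℕ → ℤ) → Set
InDγ p f γ γ' s r =
  Σ (ℕ → ℤ) λ c → IsDigits p f γ γ' c ×
  Σ (ℕ → Bool) λ ε' →
      (∀ i → i ℕ.< f → (+ 0 ≤ rule p (ε' i) (prevε f ε' i) (c i))
                      × (rule p (ε' i) (prevε f ε' i) (c i) ≤ + p - + 1))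
    × (∀ i → i ℕ.< f → r i ≡ rule p (ε' i) (prevε f ε' i) (c i))
    × (s ≅ γ' + ((ind (ε' (f ∸ 1)) (q-1 p f)
                   + sumℤ f (λ i → (c i - r i) * pw p i)) /ℕ 2) [mod q-1 p f ])

-- Sequences: 2f-periodic integer sequences, represented by their values
-- on ℕ (a 2f-periodic sequence on ℤ is determined by these).

Periodic : ℕ → (ℕ → ℤ) → Set
Periodic f σ = ∀ i → σ (i ℕ.+ 2 ℕ.* f) ≡ σ i

Active : ℕ → ℤ → ℤ → Set
Active p x y =
    ((+ 0 ≤ x) × (x ≤ + p))
  × ((+ 0 ≤ y) × (y ≤ + p))
  × (((x ≡ + 0) ⊎ (x ≡ + p)) ⊎ ((y ≡ + 0) ⊎ (y ≡ + p)))
  × (x ≢ y)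

InΣac : ℕ → ℕ → (ℕ → ℤ) → Set
InΣac p f σ = Periodic f σ × (∀ i → Active p (σ i) (σ (i ℕ.+ f)))

InΣh : ℕ → ℕ → ℤ → ℤ → (ℕ → ℤ) → Set
InΣh p f h γ' σ =
  sumℤ (2 ℕ.* f) (λ i → σ i * pw p (2 ℕ.* f ∸ 1 ∸ i))
    ≅ h - + q+1ℕ p f * γ' [mod q²-1 p f ]

-- r-value of an active pair (x , y) = (σ_i , σ_{i+f}); the four cases of
-- the definition agree on their overlaps for active pairs.
rOf : ℕ → ℤ → ℤ → ℤ
rOf p x y =
  if ⌊ y ≟ + 0 ⌋ then x - + 1
  else if ⌊ y ≟ + p ⌋ then + p - + 1 - x
  else if ⌊ x ≟ + 0 ⌋ then y - + 1
  else + p - + 1 - y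

-- components of S_Σ(σ): index j = f-1-i
SΣ-r : ℕ → ℕ → (ℕ → ℤ) → ℕ → ℤ
SΣ-r p f σ j = rOf p (σ (f ∸ 1 ∸ j)) (σ (f ∸ 1 ∸ j ℕ.+ f))

SΣ-ε : ℕ → (ℕ → ℤ) → ℕ → Bool
SΣ-ε f σ j = not ⌊ σ (f ∸ 1 ∸ j) <? σ (f ∸ 1 ∸ j ℕ.+ f) ⌋

SΣ-s : ℕ → ℕ → ℤ → (ℕ → ℤ) → ℤ
SΣ-s p f h σ =
  ((h - sumℤ f (λ j → sgn (SΣ-ε f σ j) ((+ 1 + SΣ-r p f σ j) * pw p j)))
     /ℕ q+1ℕ p f)
  - sumℤ f (λ j → ind (SΣ-ε f σ j) ((+ 1 + SΣ-r p f σ j) * pw p j))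

-- Let (s, r) ∈ D(h) ∩ D(γ,γ') with signs ε (from D(h)) and ε' (from D(γ,γ')),
-- and put t_j = 1 + r_j.  Fill the pair (σ_{f-1-j}, σ_{2f-1-j}) with (0, t_j), (p - t_j, p),
-- (t_j, 0) or (p, p - t_j) according to (ε_j, ε'_j).  Each pair is active and S_Σ reads back
-- (ε_j, r_j) from it, so S_Σ(σ) = (s, r).  With A = Σ_j σ_{f-1-j} p^j and B = Σ_j σ_{2f-1-j} p^j
-- the digit sum of σ is qA + B, where B - A = X is the signed sum defining D(h) and
-- A = Y + Z with Y = Σ_j ε_j p^j t_j and Z = Σ_j ε'_j (p - t_j) p^j.  The rule producing r_j in
-- D(γ,γ') makes 2Z telescope to ε'_{f-1}(q - 1) + Σ_j (c_j - r_j) p^j, so the two descriptions of s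
-- say s ≡ K - Y ≡ γ' + Z (mod q - 1) with K = (h - X)/(q + 1), and then
-- qA + B - (h - (q + 1)γ') = (q + 1)((γ' + Z) - (K - Y)) is divisible by q² - 1.

module Submission where

open import Defs

open import Data.Bool using (Bool; true; false; not)
open import Data.Integer as ℤ using (ℤ; +_; _+_; _-_; _*_; -_; _≤_; _<_; _≟_; _<?_; _/ℕ_)
import Data.Integer.Properties as ℤP
open import Algebra.Properties.CommutativeSemigroup ℤP.*-commutativeSemigroup using (x∙yz≈y∙xz)
open import Data.Integer.Divisibility using (_∣_; *-monoʳ-∣)
import Data.Integer.Divisibility.Signed as Signed
open import Data.Integer.DivMod using ([n/ℕd]*d≤n; n<s[n/ℕd]*d)
open import Data.Integer.Tactic.RingSolver using (solve-∀)
open import Data.Nat as ℕ using (ℕ; zero; suc; _∸_; _/_; _%_; NonZero; z≤n; s≤s)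
import Data.Nat.Properties as ℕP
open import Data.Nat.DivMod using ([m+n]%n≡m%n; m/n≡1+[m∸n]/n; m<n⇒m%n≡m; m<n⇒m/n≡0)
open import Data.Nat.Primality using (Prime)
open import Data.Product using (Σ; _×_; _,_; proj₁; proj₂)
open import Data.Sum using (inj₁; inj₂)
open import Relation.Binary.Core using (Rel)
open import Relation.Binary.Definitions using (Symmetric)
open import Relation.Binary.PropositionalEquality
open import Relation.Nullary using (yes; no; contradiction)
open import Relation.Nullary.Decidable using (⌊_⌋)

sumℤ-cong : ∀ n {g k : ℕ → ℤ} → (∀ i → i ℕ.< n → g i ≡ k i) → sumℤ n g ≡ sumℤ n k
sumℤ-cong zero    g≗k = refl
sumℤ-cong (suc n) g≗k =
  cong₂ _+_ (sumℤ-cong n (λ i i<n → g≗k i (ℕP.m<n⇒m<1+n i<n))) (g≗k n ℕP.≤-refl)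

sumℤ-+ : ∀ n (g k : ℕ → ℤ) → sumℤ n (λ i → g i + k i) ≡ sumℤ n g + sumℤ n k
sumℤ-+ zero    g k = refl
sumℤ-+ (suc n) g k rewrite sumℤ-+ n g k = interchange (sumℤ n g) (sumℤ n k) (g n) (k n)
  where
  interchange : ∀ a b c d → a + b + (c + d) ≡ a + c + (b + d)
  interchange = solve-∀

sumℤ-*ˡ : ∀ n c (g : ℕ → ℤ) → sumℤ n (λ i → c * g i) ≡ c * sumℤ n g
sumℤ-*ˡ zero    c g = sym (ℤP.*-zeroʳ c)
sumℤ-*ˡ (suc n) c g rewrite sumℤ-*ˡ n c g = sym (ℤP.*-distribˡ-+ c (sumℤ n g) (g n))

sumℤ-*ʳ : ∀ n c (g : ℕ → ℤ) → sumℤ n (λ i → g i * c) ≡ sumℤ n g * c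
sumℤ-*ʳ n c g = begin
  sumℤ n (λ i → g i * c) ≡⟨ sumℤ-cong n (λ i _ → ℤP.*-comm (g i) c) ⟩
  sumℤ n (λ i → c * g i) ≡⟨ sumℤ-*ˡ n c g ⟩
  c * sumℤ n g           ≡⟨ ℤP.*-comm c _ ⟩
  sumℤ n g * c           ∎
  where open ≡-Reasoning

sumℤ-suc : ∀ n (g : ℕ → ℤ) → sumℤ (suc n) g ≡ g 0 + sumℤ n (λ i → g (suc i))
sumℤ-suc zero    g = ℤP.+-comm (+ 0) (g 0)
sumℤ-suc (suc n) g rewrite sumℤ-suc n g = ℤP.+-assoc (g 0) _ _

sumℤ-reverse : ∀ n (g : ℕ → ℤ) → sumℤ n (λ i → g (n ∸ 1 ∸ i)) ≡ sumℤ n g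
sumℤ-reverse n g = trans (sumℤ-cong n (λ i _ → cong g (ℕP.∸-+-assoc n 1 i))) (reverse n)
  where
  reverse : ∀ n → sumℤ n (λ i → g (n ∸ suc i)) ≡ sumℤ n g
  reverse zero    = refl
  reverse (suc n) = begin
    sumℤ (suc n) (λ i → g (suc n ∸ suc i)) ≡⟨ sumℤ-suc n _ ⟩
    g n + sumℤ n (λ i → g (n ∸ suc i))     ≡⟨ cong (λ x → g n + x) (reverse n) ⟩
    g n + sumℤ n g                          ≡⟨ ℤP.+-comm (g n) _ ⟩
    sumℤ (suc n) g                          ∎
    where open ≡-Reasoning

sumℤ-++ : ∀ m n (g : ℕ → ℤ) → sumℤ (m ℕ.+ n) g ≡ sumℤ m g + sumℤ n (λ i → g (m ℕ.+ i))
sumℤ-++ m zero    g rewrite ℕP.+-identityʳ m = sym (ℤP.+-identityʳ _)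
sumℤ-++ m (suc n) g rewrite ℕP.+-suc m n | sumℤ-++ m n g = ℤP.+-assoc (sumℤ m g) _ _

sumℤ-telescope : ∀ n (g : ℕ → ℤ) → sumℤ n (λ j → g (suc j) - g j) ≡ g n - g 0
sumℤ-telescope zero    g = sym (ℤP.+-inverseʳ (g 0))
sumℤ-telescope (suc n) g rewrite sumℤ-telescope n g = collapse (g n) (g 0) (g (suc n))
  where
  collapse : ∀ a b c → a - b + (c - a) ≡ c - b
  collapse = solve-∀

i*n/ℕn≡i : ∀ i n .{{_ : NonZero n}} → (i * + n) /ℕ n ≡ i
i*n/ℕn≡i i n@(suc _) = ℤP.≤-antisym quotient≤i i≤quotient
  where
  quotient = (i * + n) /ℕ n
  quotient≤i : quotient ℤ.≤ i
  quotient≤i = ℤP.*-cancelʳ-≤-pos quotient i (+ n) ([n/ℕd]*d≤n (i * + n) n)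
  i≤quotient : i ℤ.≤ quotient
  i≤quotient = subst (i ℤ.≤_) (pred-suc quotient) (ℤP.i<j⇒i≤pred[j] i<1+quotient)
    where
    i<1+quotient : i ℤ.< + 1 + quotient
    i<1+quotient = ℤP.*-cancelʳ-<-nonNeg (+ n) (n<s[n/ℕd]*d (i * + n) n)
    pred-suc : ∀ x → - + 1 + (+ 1 + x) ≡ x
    pred-suc = solve-∀

i/ℕn*n≡i : ∀ {i} n .{{_ : NonZero n}} → + n ∣ i → (i /ℕ n) * + n ≡ i
i/ℕn*n≡i {i} n n∣i with Signed.∣ᵤ⇒∣ {+ n} {i} n∣i
... | Signed.divides k refl = cong (_* + n) (i*n/ℕn≡i k n)

≅-sym : ∀ {a b n} → a ≅ b [mod n ] → b ≅ a [mod n ]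
≅-sym {a} {b} {n} n∣a-b = Signed.∣⇒∣ᵤ {n} (subst (Signed._∣_ n) (negate-difference a b)
  (Signed.∣m⇒∣-m {n} (Signed.∣ᵤ⇒∣ {n} n∣a-b)))
  where
  negate-difference : ∀ a b → - (a - b) ≡ b - a
  negate-difference = solve-∀

≅-trans : ∀ {a b c n} → a ≅ b [mod n ] → b ≅ c [mod n ] → a ≅ c [mod n ]
≅-trans {a} {b} {c} {n} n∣a-b n∣b-c = Signed.∣⇒∣ᵤ {n} (subst (Signed._∣_ n) (add-differences a b c)
  (Signed.∣m∣n⇒∣m+n {n} {a - b} {b - c} (Signed.∣ᵤ⇒∣ {n} n∣a-b) (Signed.∣ᵤ⇒∣ {n} n∣b-c)))
  where
  add-differences : ∀ a b c → a - b + (b - c) ≡ a - c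
  add-differences = solve-∀

rOf-y≡p : ∀ p x {y} → y ≡ + p → y ≢ + 0 → rOf p x y ≡ + p - + 1 - x
rOf-y≡p p x {y} y≡p y≢0 with y ≟ + 0 | y ≟ + p
... | yes y≡0 | _       = contradiction y≡0 y≢0
... | no _    | yes _   = refl
... | no _    | no y≢p  = contradiction y≡p y≢p

rOf-x≡0 : ∀ p y → y ≢ + 0 → rOf p (+ 0) y ≡ y - + 1
rOf-x≡0 p y y≢0 with y ≟ + 0 | y ≟ + p
... | yes y≡0 | _        = contradiction y≡0 y≢0
... | no _    | yes refl = ℤP.+-identityʳ (+ p - + 1)
... | no _    | no _     = refl

rOf-x≡p : ∀ p {x} y → x ≡ + p → x ≢ + 0 → y ≢ + p → rOf p x y ≡ + p - + 1 - y
rOf-x≡p p {x} y refl x≢0 y≢p with y ≟ + 0 | y ≟ + p | x ≟ + 0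
... | yes refl | _        | _        = sym (ℤP.+-identityʳ (+ p - + 1))
... | no _     | yes y≡p  | _        = contradiction y≡p y≢p
... | no _     | no _     | yes x≡0  = contradiction x≡0 x≢0
... | no _     | no _     | no _     = refl

Active-sym : ∀ {p} → Symmetric (Active p)
Active-sym (x-range , y-range , inj₁ x-end , x≢y) = y-range , x-range , inj₂ x-end , ≢-sym x≢y
Active-sym (x-range , y-range , inj₂ y-end , x≢y) = y-range , x-range , inj₁ y-end , ≢-sym x≢y

lowerEntry upperEntry : ℤ → Bool → Bool → ℤ → ℤ
lowerEntry a false false t = + 0
lowerEntry a false true  t = a - t
lowerEntry a true  false t = t
lowerEntry a true  true  t = a
upperEntry a false false t = t
upperEntry a false true  t = a
upperEntry a true  false t = + 0
upperEntry a true  true  t = a - t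

lowerEntry-≡ : ∀ a e e' t → lowerEntry a e e' t ≡ ind e t + ind e' (a - t)
lowerEntry-≡ a false false t = refl
lowerEntry-≡ a false true  t = sym (ℤP.+-identityˡ (a - t))
lowerEntry-≡ a true  false t = sym (ℤP.+-identityʳ t)
lowerEntry-≡ a true  true  t = add-back t a
  where
  add-back : ∀ t a → a ≡ t + (a - t)
  add-back = solve-∀

upperEntry-≡ : ∀ a e e' t → upperEntry a e e' t ≡ lowerEntry a e e' t + sgn e t
upperEntry-≡ a false false t = sym (ℤP.+-identityˡ t)
upperEntry-≡ a false true  t = add-back t a
  where
  add-back : ∀ t a → a ≡ a - t + t
  add-back = solve-∀
upperEntry-≡ a true  false t = sym (ℤP.+-inverseʳ t)
upperEntry-≡ a true  true  t = refl

ind-*ˡ : ∀ e x y → ind e x * y ≡ ind e (x * y)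
ind-*ˡ false x y = ℤP.*-zeroˡ y
ind-*ˡ true  x y = refl

sgn-*ˡ : ∀ e x y → sgn e x * y ≡ sgn e (x * y)
sgn-*ˡ false x y = refl
sgn-*ˡ true  x y = sym (ℤP.neg-distribˡ-* x y)

not⌊<?⌋-< : ∀ {x y} → x < y → not ⌊ x <? y ⌋ ≡ false
not⌊<?⌋-< {x} {y} x<y with x <? y
... | yes _   = refl
... | no x≮y = contradiction x<y x≮y

not⌊<?⌋-> : ∀ {x y} → y < x → not ⌊ x <? y ⌋ ≡ true
not⌊<?⌋-> {x} {y} y<x with x <? y
... | yes x<y = contradiction y<x (ℤP.<-asym x<y)
... | no _    = refl

module _ {p : ℕ} {t : ℤ} (0<t : + 0 < t) (t≤p : t ≤ + p) where

  private
    0≤t : + 0 ≤ t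
    0≤t = ℤP.<⇒≤ 0<t
    t≢0 : t ≢ + 0
    t≢0 = ≢-sym (ℤP.<⇒≢ 0<t)
    0≤p : + 0 ≤ + p
    0≤p = ℤP.≤-trans 0≤t t≤p
    p≢0 : + p ≢ + 0
    p≢0 = ≢-sym (ℤP.<⇒≢ (ℤP.<-≤-trans 0<t t≤p))
    0≤p-t : + 0 ≤ + p - t
    0≤p-t = ℤP.i≤j⇒0≤j-i t≤p
    p-t<p : + p - t < + p
    p-t<p = subst (+ p - t <_) (ℤP.+-identityʳ (+ p)) (ℤP.+-monoʳ-< (+ p) (ℤP.neg-mono-< 0<t))
    p-t≤p : + p - t ≤ + p
    p-t≤p = ℤP.<⇒≤ p-t<p
    p-t≢p : + p - t ≢ + p
    p-t≢p = ℤP.<⇒≢ p-t<p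
    t-1≡p-1-[p-t] : + p - + 1 - (+ p - t) ≡ t - + 1
    t-1≡p-1-[p-t] = cancel (+ p) t
      where
      cancel : ∀ a t → a - + 1 - (a - t) ≡ t - + 1
      cancel = solve-∀

  entries-active : ∀ e e' → Active p (lowerEntry (+ p) e e' t) (upperEntry (+ p) e e' t)
  entries-active false false = (ℤP.≤-refl , 0≤p) , (0≤t , t≤p) , inj₁ (inj₁ refl) , ≢-sym t≢0
  entries-active false true  = (0≤p-t , p-t≤p) , (0≤p , ℤP.≤-refl) , inj₂ (inj₂ refl) , p-t≢p
  entries-active true  false = (0≤t , t≤p) , (ℤP.≤-refl , 0≤p) , inj₂ (inj₁ refl) , t≢0
  entries-active true  true  = (0≤p , ℤP.≤-refl) , (0≤p-t , p-t≤p) , inj₁ (inj₂ refl) , ≢-sym p-t≢p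

  rOf-entries : ∀ e e' → rOf p (lowerEntry (+ p) e e' t) (upperEntry (+ p) e e' t) ≡ t - + 1
  rOf-entries false false = rOf-x≡0 p t t≢0
  rOf-entries false true  = trans (rOf-y≡p p (+ p - t) refl p≢0) t-1≡p-1-[p-t]
  rOf-entries true  false = refl
  rOf-entries true  true  = trans (rOf-x≡p p (+ p - t) refl p≢0 p-t≢p) t-1≡p-1-[p-t]

  sign-entries : ∀ e e' → not ⌊ lowerEntry (+ p) e e' t <? upperEntry (+ p) e e' t ⌋ ≡ e
  sign-entries false false = not⌊<?⌋-< 0<t
  sign-entries false true  = not⌊<?⌋-< p-t<p
  sign-entries true  false = not⌊<?⌋-> 0<t
  sign-entries true  true  = not⌊<?⌋-> p-t<p

alternate : ∀ {a} {A : Set a} → ℕ → A → A → A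
alternate zero    x y = x
alternate (suc k) x y = alternate k y x

alternate-sym : ∀ {a ℓ} {A : Set a} {R : Rel A ℓ} → Symmetric R →
  ∀ k {x y} → R x y → R (alternate k x y) (alternate k y x)
alternate-sym R-sym zero    Rxy = Rxy
alternate-sym {R = R} R-sym (suc k) Rxy = alternate-sym {R = R} R-sym k (R-sym Rxy)

pw-+ : ∀ p m n → pw p (m ℕ.+ n) ≡ pw p m * pw p n
pw-+ p m n = trans (cong +_ (ℕP.^-distribˡ-+-* p m n)) (ℤP.pos-* (p ℕ.^ m) (p ℕ.^ n))

-- σ_i = X_{F-1-i} and σ_{i+F} = Y_{F-1-i} for i < F, extended 2F-periodically.
interleave : (F : ℕ) .{{_ : NonZero F}} → (ℕ → ℤ) → (ℕ → ℤ) → ℕ → ℤ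
interleave F X Y n = alternate (n / F) (X (F ∸ 1 ∸ n % F)) (Y (F ∸ 1 ∸ n % F))

module _ (F : ℕ) .{{F≢0 : NonZero F}} where

  interleave-+F : ∀ X Y n → interleave F X Y (n ℕ.+ F) ≡ interleave F Y X n
  interleave-+F X Y n = cong₂ (λ k m → alternate k (X (F ∸ 1 ∸ m)) (Y (F ∸ 1 ∸ m)))
    (trans (m/n≡1+[m∸n]/n (ℕP.m≤n+m F n)) (cong (λ m → suc (m / F)) (ℕP.m+n∸n≡m n F)))
    ([m+n]%n≡m%n n F)

  interleave-periodic : ∀ X Y → Periodic F (interleave F X Y)
  interleave-periodic X Y n = begin
    interleave F X Y (n ℕ.+ 2 ℕ.* F)     ≡⟨ cong (interleave F X Y) (two-steps n) ⟩
    interleave F X Y (n ℕ.+ F ℕ.+ F)     ≡⟨ interleave-+F X Y (n ℕ.+ F) ⟩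
    interleave F Y X (n ℕ.+ F)           ≡⟨ interleave-+F Y X n ⟩
    interleave F X Y n                   ∎
    where
    open ≡-Reasoning
    two-steps : ∀ n → n ℕ.+ 2 ℕ.* F ≡ n ℕ.+ F ℕ.+ F
    two-steps n rewrite ℕP.+-identityʳ F = sym (ℕP.+-assoc n F F)

  interleave-< : ∀ X Y {i} → i ℕ.< F → interleave F X Y i ≡ X (F ∸ 1 ∸ i)
  interleave-< X Y i<F = cong₂ (λ k m → alternate k (X (F ∸ 1 ∸ m)) (Y (F ∸ 1 ∸ m)))
    (m<n⇒m/n≡0 i<F) (m<n⇒m%n≡m i<F)

  reflect-< : ∀ i → F ∸ 1 ∸ i ℕ.< F
  reflect-< i = ℕP.m≤pred[n]⇒suc[m]≤n (ℕP.m∸n≤m (F ∸ 1) i)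

  interleave-reflect : ∀ X Y {j} → j ℕ.< F → interleave F X Y (F ∸ 1 ∸ j) ≡ X j
  interleave-reflect X Y {j} j<F = trans (interleave-< X Y (reflect-< j))
                                        (cong X (ℕP.m∸[m∸n]≡n (ℕP.<⇒≤pred j<F)))

  interleave-reflect-+F : ∀ X Y {j} → j ℕ.< F → interleave F X Y (F ∸ 1 ∸ j ℕ.+ F) ≡ Y j
  interleave-reflect-+F X Y j<F = trans (interleave-+F X Y _) (interleave-reflect Y X j<F)

  interleave-pairs : ∀ {ℓ} {R : Rel ℤ ℓ} → Symmetric R → ∀ X Y → (∀ j → j ℕ.< F → R (X j) (Y j)) →
    ∀ n → R (interleave F X Y n) (interleave F X Y (n ℕ.+ F))
  interleave-pairs {R = R} R-sym X Y R-XY n rewrite interleave-+F X Y n =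
    alternate-sym {R = R} R-sym (n / F) (R-XY _ (reflect-< (n % F)))

  private
    2F∸1≡F+[F∸1] : 2 ℕ.* F ∸ 1 ≡ F ℕ.+ (F ∸ 1)
    2F∸1≡F+[F∸1] rewrite ℕP.+-identityʳ F = ℕP.+-∸-assoc F (ℕ.>-nonZero⁻¹ F)

    2F∸1∸i≡F+[F∸1∸i] : ∀ {i} → i ℕ.< F → 2 ℕ.* F ∸ 1 ∸ i ≡ F ℕ.+ (F ∸ 1 ∸ i)
    2F∸1∸i≡F+[F∸1∸i] {i} i<F = begin
      2 ℕ.* F ∸ 1 ∸ i       ≡⟨ cong (_∸ i) 2F∸1≡F+[F∸1] ⟩
      F ℕ.+ (F ∸ 1) ∸ i     ≡⟨ ℕP.+-∸-assoc F (ℕP.<⇒≤pred i<F) ⟩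
      F ℕ.+ (F ∸ 1 ∸ i)     ∎
      where open ≡-Reasoning

    2F∸1∸[F+i]≡F∸1∸i : ∀ i → 2 ℕ.* F ∸ 1 ∸ (F ℕ.+ i) ≡ F ∸ 1 ∸ i
    2F∸1∸[F+i]≡F∸1∸i i = trans (cong (_∸ (F ℕ.+ i)) 2F∸1≡F+[F∸1]) (ℕP.[m+n]∸[m+o]≡n∸o F (F ∸ 1) i)

  interleave-digitSum : ∀ p X Y →
    sumℤ (2 ℕ.* F) (λ i → interleave F X Y i * pw p (2 ℕ.* F ∸ 1 ∸ i))
      ≡ pw p F * sumℤ F (λ j → X j * pw p j) + sumℤ F (λ j → Y j * pw p j)
  interleave-digitSum p X Y = begin
    sumℤ (2 ℕ.* F) G                             ≡⟨ cong (λ n → sumℤ n G) (cong (F ℕ.+_) (ℕP.+-identityʳ F)) ⟩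
    sumℤ (F ℕ.+ F) G                             ≡⟨ sumℤ-++ F F G ⟩
    sumℤ F G + sumℤ F (λ i → G (F ℕ.+ i))        ≡⟨ cong₂ _+_ lower-half upper-half ⟩
    pw p F * sumℤ F (λ j → X j * pw p j) + sumℤ F (λ j → Y j * pw p j) ∎
    where
    open ≡-Reasoning
    G : ℕ → ℤ
    G i = interleave F X Y i * pw p (2 ℕ.* F ∸ 1 ∸ i)
    lower-half : sumℤ F G ≡ pw p F * sumℤ F (λ j → X j * pw p j)
    lower-half = begin
      sumℤ F G                                          ≡⟨ sumℤ-cong F lower-term ⟩
      sumℤ F (λ i → pw p F * (X (F ∸ 1 ∸ i) * pw p (F ∸ 1 ∸ i))) ≡⟨ sumℤ-reverse F (λ j → pw p F * (X j * pw p j)) ⟩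
      sumℤ F (λ j → pw p F * (X j * pw p j))            ≡⟨ sumℤ-*ˡ F (pw p F) _ ⟩
      pw p F * sumℤ F (λ j → X j * pw p j)              ∎
      where
      lower-term : ∀ i → i ℕ.< F → G i ≡ pw p F * (X (F ∸ 1 ∸ i) * pw p (F ∸ 1 ∸ i))
      lower-term i i<F = begin
        G i ≡⟨ cong₂ _*_ (interleave-< X Y i<F) (cong (pw p) (2F∸1∸i≡F+[F∸1∸i] i<F)) ⟩
        X (F ∸ 1 ∸ i) * pw p (F ℕ.+ (F ∸ 1 ∸ i))         ≡⟨ cong (X (F ∸ 1 ∸ i) *_) (pw-+ p F _) ⟩
        X (F ∸ 1 ∸ i) * (pw p F * pw p (F ∸ 1 ∸ i))       ≡⟨ x∙yz≈y∙xz (X (F ∸ 1 ∸ i)) (pw p F) (pw p (F ∸ 1 ∸ i)) ⟩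
        pw p F * (X (F ∸ 1 ∸ i) * pw p (F ∸ 1 ∸ i))       ∎
    upper-half : sumℤ F (λ i → G (F ℕ.+ i)) ≡ sumℤ F (λ j → Y j * pw p j)
    upper-half = trans (sumℤ-cong F upper-term) (sumℤ-reverse F (λ j → Y j * pw p j))
      where
      upper-term : ∀ i → i ℕ.< F → G (F ℕ.+ i) ≡ Y (F ∸ 1 ∸ i) * pw p (F ∸ 1 ∸ i)
      upper-term i i<F = cong₂ _*_
        (trans (cong (interleave F X Y) (ℕP.+-comm F i)) (trans (interleave-+F X Y i) (interleave-< Y X i<F)))
        (cong (pw p) (2F∸1∸[F+i]≡F∸1∸i i))

ind-- : ∀ e x y → ind e x - ind e y ≡ ind e (x - y)
ind-- false x y = refl
ind-- true  x y = refl

prevε-length : ∀ n ε → prevε n ε n ≡ ε (n ∸ 1)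
prevε-length zero    ε = refl
prevε-length (suc n) ε = refl

-- Each case of `rule` makes twice the flipped digit equal to c_i - r_i plus the carry
-- ε'_i p^{i+1} - ε'_{i-1} p^i; these carries telescope in flipSum-double.
rule-carry : ∀ p e e' c P →
  ind e (+ p - (+ 1 + rule p e e' c)) * P * + 2
    ≡ (c - rule p e e' c) * P + (ind e (+ p * P) - ind e' P)
rule-carry p false false c P = identity c P
  where
  identity : ∀ c P → + 0 * P * + 2 ≡ (c - c) * P + (+ 0 - + 0)
  identity = solve-∀
rule-carry p false true  c P = identity c P
  where
  identity : ∀ c P → + 0 * P * + 2 ≡ (c - (c - + 1)) * P + (+ 0 - P)
  identity = solve-∀
rule-carry p true  false c P = identity (+ p) c P
  where
  identity : ∀ a c P → (a - (+ 1 + (a - + 2 - c))) * P * + 2 ≡ (c - (a - + 2 - c)) * P + (a * P - + 0)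
  identity = solve-∀
rule-carry p true  true  c P = identity (+ p) c P
  where
  identity : ∀ a c P → (a - (+ 1 + (a - + 1 - c))) * P * + 2 ≡ (c - (a - + 1 - c)) * P + (a * P - P)
  identity = solve-∀

flipSum-double : ∀ p n (ε' : ℕ → Bool) (c r : ℕ → ℤ) →
  (∀ j → j ℕ.< n → r j ≡ rule p (ε' j) (prevε n ε' j) (c j)) →
  sumℤ n (λ j → ind (ε' j) (+ p - (+ 1 + r j)) * pw p j) * + 2
    ≡ ind (ε' (n ∸ 1)) (pw p n - + 1) + sumℤ n (λ j → (c j - r j) * pw p j)
flipSum-double p n ε' c r r≡rule = begin
  sumℤ n (λ j → ind (ε' j) (+ p - (+ 1 + r j)) * pw p j) * + 2
    ≡⟨ sym (sumℤ-*ʳ n (+ 2) _) ⟩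
  sumℤ n (λ j → ind (ε' j) (+ p - (+ 1 + r j)) * pw p j * + 2)
    ≡⟨ sumℤ-cong n term ⟩
  sumℤ n (λ j → (c j - r j) * pw p j + (carry (suc j) - carry j))
    ≡⟨ sumℤ-+ n _ _ ⟩
  S + sumℤ n (λ j → carry (suc j) - carry j)
    ≡⟨ cong (λ x → S + x) (sumℤ-telescope n carry) ⟩
  S + (carry n - carry 0)
    ≡⟨ cong (λ e → S + (ind e (pw p n) - carry 0)) (prevε-length n ε') ⟩
  S + (ind (ε' (n ∸ 1)) (pw p n) - ind (ε' (n ∸ 1)) (+ 1))
    ≡⟨ cong (λ x → S + x) (ind-- (ε' (n ∸ 1)) (pw p n) (+ 1)) ⟩
  S + ind (ε' (n ∸ 1)) (pw p n - + 1)
    ≡⟨ ℤP.+-comm S (ind (ε' (n ∸ 1)) (pw p n - + 1)) ⟩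
  ind (ε' (n ∸ 1)) (pw p n - + 1) + S ∎
  where
  open ≡-Reasoning
  S : ℤ
  S = sumℤ n (λ j → (c j - r j) * pw p j)
  carry : ℕ → ℤ
  carry j = ind (prevε n ε' j) (pw p j)
  term : ∀ j → j ℕ.< n →
    ind (ε' j) (+ p - (+ 1 + r j)) * pw p j * + 2 ≡ (c j - r j) * pw p j + (carry (suc j) - carry j)
  term j j<n rewrite r≡rule j j<n | ℤP.pos-* p (p ℕ.^ j) =
    rule-carry p (ε' j) (prevε n ε' j) (c j) (pw p j)

digitSum-≅ : ∀ q A X Y Z K γ' {B h} → B ≡ A + X → h ≡ X + K * (+ 1 + q) → A ≡ Y + Z →
  γ' + Z ≅ K - Y [mod q - + 1 ] → q * A + B ≅ h - (+ 1 + q) * γ' [mod q * q - + 1 ]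
digitSum-≅ q A X Y Z K γ' refl refl refl q-1∣d =
  subst₂ _∣_ (factor q) (expand q X Y Z K γ') (*-monoʳ-∣ (+ 1 + q) q-1∣d)
  where
  factor : ∀ q → (+ 1 + q) * (q - + 1) ≡ q * q - + 1
  factor = solve-∀
  expand : ∀ q X Y Z K γ' → (+ 1 + q) * (γ' + Z - (K - Y))
    ≡ q * (Y + Z) + (Y + Z + X) - (X + K * (+ 1 + q) - (+ 1 + q) * γ')
  expand = solve-∀

weight-bounds : ∀ {p r} → + 0 ≤ r → r ≤ + p - + 1 → + 0 < + 1 + r × + 1 + r ≤ + p
weight-bounds {p} {r} 0≤r r≤p-1 =
  ℤP.suc[i]≤j⇒i<j (ℤP.+-monoʳ-≤ (+ 1) 0≤r) ,
  subst (+ 1 + r ≤_) (add-back (+ p)) (ℤP.+-monoʳ-≤ (+ 1) r≤p-1)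
  where
  add-back : ∀ a → + 1 + (a - + 1) ≡ a
  add-back = solve-∀

module Preimage (p f : ℕ) .{{f≢0 : NonZero f}} (ε ε' : ℕ → Bool) (r : ℕ → ℤ) where

  t X Y σ : ℕ → ℤ
  t j = + 1 + r j
  X j = lowerEntry (+ p) (ε j) (ε' j) (t j)
  Y j = upperEntry (+ p) (ε j) (ε' j) (t j)
  σ = interleave f X Y

  A B Xh Yh Z : ℤ
  A  = sumℤ f (λ j → X j * pw p j)
  B  = sumℤ f (λ j → Y j * pw p j)
  Xh = sumℤ f (λ j → sgn (ε j) (pw p j * t j))
  Yh = sumℤ f (λ j → ind (ε j) (pw p j * t j))
  Z  = sumℤ f (λ j → ind (ε' j) (+ p - t j) * pw p j)

  B≡A+Xh : B ≡ A + Xh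
  B≡A+Xh = trans (sumℤ-cong f (λ j _ → term j)) (sumℤ-+ f _ _)
    where
    term : ∀ j → Y j * pw p j ≡ X j * pw p j + sgn (ε j) (pw p j * t j)
    term j = begin
      Y j * pw p j                           ≡⟨ cong (_* pw p j) (upperEntry-≡ (+ p) (ε j) (ε' j) (t j)) ⟩
      (X j + sgn (ε j) (t j)) * pw p j       ≡⟨ ℤP.*-distribʳ-+ (pw p j) (X j) _ ⟩
      X j * pw p j + sgn (ε j) (t j) * pw p j ≡⟨ cong (λ x → X j * pw p j + x) (sgn-*ˡ (ε j) (t j) (pw p j)) ⟩
      X j * pw p j + sgn (ε j) (t j * pw p j) ≡⟨ cong (λ x → X j * pw p j + sgn (ε j) x) (ℤP.*-comm (t j) (pw p j)) ⟩
      X j * pw p j + sgn (ε j) (pw p j * t j) ∎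
      where open ≡-Reasoning

  A≡Yh+Z : A ≡ Yh + Z
  A≡Yh+Z = trans (sumℤ-cong f (λ j _ → term j)) (sumℤ-+ f _ _)
    where
    term : ∀ j → X j * pw p j ≡ ind (ε j) (pw p j * t j) + ind (ε' j) (+ p - t j) * pw p j
    term j = begin
      X j * pw p j
        ≡⟨ cong (_* pw p j) (lowerEntry-≡ (+ p) (ε j) (ε' j) (t j)) ⟩
      (ind (ε j) (t j) + ind (ε' j) (+ p - t j)) * pw p j
        ≡⟨ ℤP.*-distribʳ-+ (pw p j) (ind (ε j) (t j)) _ ⟩
      ind (ε j) (t j) * pw p j + ind (ε' j) (+ p - t j) * pw p j
        ≡⟨ cong (_+ ind (ε' j) (+ p - t j) * pw p j)
                (trans (ind-*ˡ (ε j) (t j) (pw p j)) (cong (ind (ε j)) (ℤP.*-comm (t j) (pw p j)))) ⟩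
      ind (ε j) (pw p j * t j) + ind (ε' j) (+ p - t j) * pw p j ∎
      where open ≡-Reasoning

  σ-digitSum : sumℤ (2 ℕ.* f) (λ i → σ i * pw p (2 ℕ.* f ∸ 1 ∸ i)) ≡ pw p f * A + B
  σ-digitSum = interleave-digitSum f p X Y

  module _ (r-range : WeightRange p f r) where

    private
      t-bounds : ∀ j → j ℕ.< f → + 0 < t j × t j ≤ + p
      t-bounds j j<f = weight-bounds (proj₁ (r-range j j<f)) (proj₂ (r-range j j<f))

    σ-active : InΣac p f σ
    σ-active = interleave-periodic f X Y , interleave-pairs f {R = Active p} Active-sym X Y active
      where
      active : ∀ j → j ℕ.< f → Active p (X j) (Y j)
      active j j<f = let (0<t , t≤p) = t-bounds j j<f in entries-active 0<t t≤p (ε j) (ε' j)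

    SΣ-r-σ : ∀ j → j ℕ.< f → SΣ-r p f σ j ≡ r j
    SΣ-r-σ j j<f rewrite interleave-reflect f X Y j<f | interleave-reflect-+F f X Y j<f =
      let (0<t , t≤p) = t-bounds j j<f in
      trans (rOf-entries 0<t t≤p (ε j) (ε' j)) (cancel (r j))
      where
      cancel : ∀ r → + 1 + r - + 1 ≡ r
      cancel = solve-∀

    SΣ-ε-σ : ∀ j → j ℕ.< f → SΣ-ε f σ j ≡ ε j
    SΣ-ε-σ j j<f rewrite interleave-reflect f X Y j<f | interleave-reflect-+F f X Y j<f =
      let (0<t , t≤p) = t-bounds j j<f in sign-entries 0<t t≤p (ε j) (ε' j)

    SΣ-s-σ : ∀ h → SΣ-s p f h σ ≡ (h - Xh) /ℕ q+1ℕ p f - Yh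
    SΣ-s-σ h = cong₂ (λ x y → (h - x) /ℕ q+1ℕ p f - y) (sumℤ-cong f (term sgn)) (sumℤ-cong f (term ind))
      where
      term : ∀ (φ : Bool → ℤ → ℤ) j → j ℕ.< f →
        φ (SΣ-ε f σ j) ((+ 1 + SΣ-r p f σ j) * pw p j) ≡ φ (ε j) (pw p j * t j)
      term φ j j<f = trans (cong₂ (λ e r → φ e ((+ 1 + r) * pw p j)) (SΣ-ε-σ j j<f) (SΣ-r-σ j j<f))
                           (cong (φ (ε j)) (ℤP.*-comm (t j) (pw p j)))

proposition4p1p4 : ∀ (p f : ℕ) → Prime p → 2 ℕ.< p → 2 ℕ.≤ f →
    ∀ (h γ γ' : ℤ) → Coherent p f h γ γ' →
    ∀ (s : ℤ) (r : ℕ → ℤ) → WeightRange p f r →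
    InDh p f h s r → InDγ p f γ γ' s r →
    Σ (ℕ → ℤ) λ σ → InΣac p f σ × InΣh p f h γ' σ
    × WeightEq p f (SΣ-s p f h σ) (SΣ-r p f σ) s r
proposition4p1p4 p f _ _ 2≤f h γ γ' _ s r r-range
  (ε , h≅Xh , s≅K-Yh) (c , _ , ε' , _ , r≡rule , s≅γ'+E/2) =
  σ , σ-active r-range , σ∈Σh , SΣ-s≅s , SΣ-r-σ r-range
  where
  instance
    f≢0 : NonZero f
    f≢0 = ℕ.>-nonZero (ℕP.<-≤-trans (s≤s z≤n) 2≤f)
  open Preimage p f ε ε' r

  K : ℤ
  K = (h - Xh) /ℕ q+1ℕ p f

  h≡Xh+K[q+1] : h ≡ Xh + K * (+ 1 + qZ p f)
  h≡Xh+K[q+1] = trans (sym (add-back Xh h)) (cong (λ x → Xh + x) (sym (i/ℕn*n≡i (q+1ℕ p f) h≅Xh)))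
    where
    add-back : ∀ x y → x + (y - x) ≡ y
    add-back = solve-∀

  s≅γ'+Z : s ≅ γ' + Z [mod q-1 p f ]
  s≅γ'+Z = subst (λ z → s ≅ γ' + z [mod q-1 p f ])
    (trans (cong (_/ℕ 2) (sym (flipSum-double p f ε' c r r≡rule))) (i*n/ℕn≡i Z 2)) s≅γ'+E/2

  SΣ-s≅s : SΣ-s p f h σ ≅ s [mod q-1 p f ]
  SΣ-s≅s = ≅-sym {s} {SΣ-s p f h σ} {q-1 p f}
    (subst (λ x → s ≅ x [mod q-1 p f ]) (sym (SΣ-s-σ r-range h)) s≅K-Yh)

  σ∈Σh : InΣh p f h γ' σ
  σ∈Σh = subst (λ x → x ≅ h - + q+1ℕ p f * γ' [mod q²-1 p f ]) (sym σ-digitSum)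
    (digitSum-≅ (qZ p f) A Xh Yh Z K γ' B≡A+Xh h≡Xh+K[q+1] A≡Yh+Z γ'+Z≅K-Yh)
    where
    γ'+Z≅K-Yh : γ' + Z ≅ K - Yh [mod q-1 p f ]
    γ'+Z≅K-Yh = ≅-trans {γ' + Z} {s} {K - Yh} {q-1 p f} (≅-sym {s} {γ' + Z} {q-1 p f} s≅γ'+Z) s≅K-Yh
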